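{- Let $k$ be an odd positive integer and let $n$ be an integer with $\gcd(n,k)=\gcd(n+1,k)=1$. Let $N_k(n)$ be the number of pairs of positive integers $(b_1,b_2)$ such that $b_1\le (k-1)/2$, $b_2\le (k-1)/2$, $b_1+b_2\ge (k+1)/2$, and $b_2\equiv n b_1 \pmod{k}$. Then \[ N_k(n)\equiv \left\lfloor \frac{k+1}{4}\right\rfloor \pmod 2. \] -}

module Defs where

open import Data.Nat as ℕ using (ℕ; suc; _+_; _≤_; _≤?_; _/_)
open import Data.Integer as ℤ using (ℤ; +_; ∣_∣)
open import Data.Integer.Divisibility using (_∣_)
import Data.Nat.Divisibility as ℕDiv
open import Data.List using (List; length; filter; cartesianProduct; map; upTo)
open import Data.Product using (_×_; _,_; proj₁; proj₂)
open import Relation.Nullary using (Dec)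
open import Relation.Nullary.Decidable using (_×-dec_)

CongMod : ℕ → ℤ → ℕ × ℕ → Set
CongMod k n (b₁ , b₂) = (+ k) ∣ ((+ b₂) ℤ.- (n ℤ.* (+ b₁)))

-- The defining conditions of a pair counted by N_k(n) (b₁,b₂ range over
-- {1,…,(k-1)/2} by construction of the candidate list below).
Counted : ℕ → ℤ → ℕ × ℕ → Set
Counted k n (b₁ , b₂) = ((k + 1) / 2 ≤ b₁ + b₂) × CongMod k n (b₁ , b₂)

counted? : (k : ℕ) (n : ℤ) (p : ℕ × ℕ) → Dec (Counted k n p)
counted? k n (b₁ , b₂) =
  ((k + 1) / 2 ≤? b₁ + b₂) ×-dec
  ℕDiv._∣?_ k ∣ (+ b₂) ℤ.- (n ℤ.* (+ b₁)) ∣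

positivesUpTo : ℕ → List ℕ
positivesUpTo m = map suc (upTo m)

N : ℕ → ℤ → ℕ
N k n = length (filter (counted? k n)
          (cartesianProduct (positivesUpTo ((k ℕ.∸ 1) / 2))
                            (positivesUpTo ((k ℕ.∸ 1) / 2))))

-- Write k = 2h + 1 and, for 1 ≤ b ≤ h, let y and z be the residues in [0, k) of n b and
-- of -(n + 1) b.  Both are nonzero since n and n + 1 are units, and b + y + z ≡ 0 (mod k), so
-- b + y + z is k or 2k.  The pairs counted in row b are exactly (b, y) when y ≤ h < b + y,
-- and a case analysis on whether y and z exceed h shows that this number has the parity of
-- b + |y| + |z|, where |r| = min(r, k - r).  As in Gauss's lemma, b ↦ |n b| and b ↦ |(n + 1) b|
-- permute {1, …, h}; summing over the rows gives N ≡ 3 (1 + ⋯ + h) ≡ ⌊(h + 1)/2⌋ = ⌊(k + 1)/4⌋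
-- (mod 2).
module Submission where

open import Data.Bool.Base using (if_then_else_)
open import Data.Fin.Base using (Fin; zero; suc; toℕ; fromℕ<; punchOut)
open import Data.Fin.Permutation using (permutation)
open import Data.Fin.Properties
  using (any?; injective⇒≤; punchOut-injective; toℕ-fromℕ<; toℕ<n; toℕ-injective)
  renaming (_≟_ to _≟ᶠ_)
open import Data.Integer.Base as ℤ using (ℤ; +_; 0ℤ; 1ℤ; _%ℕ_; _/ℕ_) renaming (_+_ to _+ℤ_)
import Data.Integer.Properties as ℤ
import Data.Integer.Divisibility.Signed as ℤ
import Data.Integer.Tactic.RingSolver as ℤ
open import Data.Integer.Coprimality using (coprime-divisor)
open import Data.Integer.DivMod using (n%ℕd<d; a≡a%ℕn+[a/ℕn]*n)
open import Data.Integer.GCD using (gcd)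
open import Data.List.Base
  using (List; []; _∷_; _++_; map; filter; length; cartesianProduct; applyUpTo)
open import Data.List.Properties using (map-++; map-∘; map-applyUpTo)
open import Data.Nat.Base
open import Data.Nat.Properties
import Data.Nat.Coprimality as Coprimality
open import Data.Nat.Divisibility
  using (_∣_; divides; _∣0; ∣-refl; ∣m∣n⇒∣m+n; ∣m+n∣m⇒∣n; n∣m⇒m%n≡0; >⇒∤)
open import Data.Nat.DivMod
  using ( [m+kn]%n≡m%n; %-distribˡ-+; m%n%n≡m%n; m≡m%n+[m/n]*n; m*n/n≡m; m*n/m*o≡n/o
        ; m/n≡1+[m∸n]/n)
import Data.Nat.GCD as ℕ
import Data.Nat.ListAction as List
open import Data.Nat.ListAction.Properties using (sum-++)
open import Data.Nat.Tactic.RingSolver using (solve-∀)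
open import Data.Product.Base using (∃; _×_; _,_; proj₁; proj₂)
open import Data.Sum.Base using (_⊎_; inj₁; inj₂)
open import Function.Base using (_∘_; id)
open import Function.Bundles using (_⇔_; mk⇔; Equivalence)
open import Function.Definitions using (Injective)
open import Relation.Binary.PropositionalEquality
open import Relation.Nullary.Decidable using (Dec; yes; no; does; does-⇔; _×-dec_)
open import Relation.Nullary.Negation using (¬_; contradiction)

open import Algebra.Properties.CommutativeSemigroup +-commutativeSemigroup
  using (x∙yz≈y∙xz; xy∙z≈xz∙y)
open import Algebra.Properties.CommutativeMonoid.Sum +-0-commutativeMonoid
  using (sum; sum-syntax; sum-cong-≗; sum-replicate-zero; ∑-distrib-+; sum-permute)

open import Defs

-- Parity and multiples

n+n≡n*2 : ∀ n → n + n ≡ n * 2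
n+n≡n*2 = solve-∀

2∣n+n : ∀ n → 2 ∣ n + n
2∣n+n n = divides n (n+n≡n*2 n)

2∣m+n⇒m%2≡n%2 : ∀ m n → 2 ∣ m + n → m % 2 ≡ n % 2
2∣m+n⇒m%2≡n%2 m n 2∣m+n = begin
  m % 2                      ≡⟨ [m+kn]%n≡m%n m n 2 ⟨
  (m + n * 2) % 2            ≡⟨ cong (λ t → (m + t) % 2) (n+n≡n*2 n) ⟨
  (m + (n + n)) % 2          ≡⟨ cong (_% 2) (+-assoc m n n) ⟨
  (m + n + n) % 2            ≡⟨ %-distribˡ-+ (m + n) n 2 ⟩
  ((m + n) % 2 + n % 2) % 2  ≡⟨ cong (λ r → (r + n % 2) % 2) (n∣m⇒m%n≡0 (m + n) 2 2∣m+n) ⟩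
  n % 2 % 2                  ≡⟨ m%n%n≡m%n n 2 ⟩
  n % 2                      ∎
  where open ≡-Reasoning

middle-multiple : ∀ {d s t} → d ∣ s → d ∣ t → t < s → s < t + d + d → s ≡ t + d
middle-multiple {d} (divides q refl) (divides p refl) p*d<q*d q*d<p*d+d+d = begin
  q * d        ≡⟨ cong (_* d) q≡1+p ⟩
  (1 + p) * d  ≡⟨ +-comm d (p * d) ⟩
  p * d + d    ∎
  where
  open ≡-Reasoning
  p*d+d+d≡[2+p]*d : ∀ p d → p * d + d + d ≡ (2 + p) * d
  p*d+d+d≡[2+p]*d = solve-∀

  q≡1+p : q ≡ 1 + p
  q≡1+p = ≤-antisym
    (s≤s⁻¹ (*-cancelʳ-< d q (2 + p) (subst (q * d <_) (p*d+d+d≡[2+p]*d p d) q*d<p*d+d+d)))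
    (*-cancelʳ-< d p q p*d<q*d)

∣∧<⇒≡0 : ∀ {k d} → k ∣ d → d < k → d ≡ 0
∣∧<⇒≡0 {d = zero}  _   _   = refl
∣∧<⇒≡0 {d = suc d} k∣d d<k = contradiction k∣d (>⇒∤ d<k)

-- Counting with indicators

indicator : {A : Set} → Dec A → ℕ
indicator a? = if does a? then 1 else 0

indicator-yes : {A : Set} (a? : Dec A) → A → indicator a? ≡ 1
indicator-yes (yes _) _ = refl
indicator-yes (no ¬a) a = contradiction a ¬a

indicator-no : {A : Set} (a? : Dec A) → ¬ A → indicator a? ≡ 0
indicator-no (yes a) ¬a = contradiction a ¬a
indicator-no (no _)  _  = refl

indicator-⇔ : {A B : Set} → A ⇔ B → (a? : Dec A) (b? : Dec B) → indicator a? ≡ indicator b?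
indicator-⇔ A⇔B a? b? = cong (λ b → if b then 1 else 0) (does-⇔ A⇔B a? b?)

length-filter≡∑indicator : {A : Set} {P : A → Set} (P? : ∀ x → Dec (P x)) (xs : List A) →
                           length (filter P? xs) ≡ List.sum (map (indicator ∘ P?) xs)
length-filter≡∑indicator P? []       = refl
length-filter≡∑indicator P? (x ∷ xs) with P? x
... | yes _ = cong suc (length-filter≡∑indicator P? xs)
... | no  _ = length-filter≡∑indicator P? xs

∑-map-cartesianProduct : {A B : Set} (f : A × B → ℕ) (xs : List A) (ys : List B) →
  List.sum (map f (cartesianProduct xs ys)) ≡
  List.sum (map (λ x → List.sum (map (λ y → f (x , y)) ys)) xs)
∑-map-cartesianProduct f []       ys = refl
∑-map-cartesianProduct f (x ∷ xs) ys = begin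
  List.sum (map f (map (x ,_) ys ++ cartesianProduct xs ys))
    ≡⟨ cong List.sum (map-++ f (map (x ,_) ys) (cartesianProduct xs ys)) ⟩
  List.sum (map f (map (x ,_) ys) ++ map f (cartesianProduct xs ys))
    ≡⟨ sum-++ (map f (map (x ,_) ys)) (map f (cartesianProduct xs ys)) ⟩
  List.sum (map f (map (x ,_) ys)) + List.sum (map f (cartesianProduct xs ys))
    ≡⟨ cong₂ _+_ (cong List.sum (sym (map-∘ ys))) (∑-map-cartesianProduct f xs ys) ⟩
  List.sum (map (λ y → f (x , y)) ys) +
  List.sum (map (λ x → List.sum (map (λ y → f (x , y)) ys)) xs)
    ∎
  where open ≡-Reasoning

∑-map-applyUpTo : {A : Set} (f : A → ℕ) (g : ℕ → A) (n : ℕ) →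
                  List.sum (map f (applyUpTo g n)) ≡ ∑[ i < n ] f (g (toℕ i))
∑-map-applyUpTo f g zero    = refl
∑-map-applyUpTo f g (suc n) = cong (_+_ (f (g 0))) (∑-map-applyUpTo f (g ∘ suc) n)

∑-map-positivesUpTo : (f : ℕ → ℕ) (n : ℕ) →
                      List.sum (map f (positivesUpTo n)) ≡ ∑[ i < n ] f (suc (toℕ i))
∑-map-positivesUpTo f n =
  trans (cong (List.sum ∘ map f) (map-applyUpTo id suc n)) (∑-map-applyUpTo f suc n)

length-filter-positivesUpTo² : {P : ℕ × ℕ → Set} (P? : ∀ p → Dec (P p)) (n : ℕ) →
  length (filter P? (cartesianProduct (positivesUpTo n) (positivesUpTo n))) ≡
  ∑[ i < n ] ∑[ j < n ] indicator (P? (suc (toℕ i) , suc (toℕ j)))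
length-filter-positivesUpTo² P? n = begin
  length (filter P? (cartesianProduct ps ps))
    ≡⟨ length-filter≡∑indicator P? (cartesianProduct ps ps) ⟩
  List.sum (map (indicator ∘ P?) (cartesianProduct ps ps))
    ≡⟨ ∑-map-cartesianProduct (indicator ∘ P?) ps ps ⟩
  List.sum (map row ps)
    ≡⟨ ∑-map-positivesUpTo row n ⟩
  ∑[ i < n ] row (suc (toℕ i))
    ≡⟨ sum-cong-≗ {n} (λ i → ∑-map-positivesUpTo (λ b₂ → indicator (P? (suc (toℕ i) , b₂))) n) ⟩
  ∑[ i < n ] ∑[ j < n ] indicator (P? (suc (toℕ i) , suc (toℕ j)))
    ∎
  where
  open ≡-Reasoning
  ps : List ℕ
  ps = positivesUpTo n

  row : ℕ → ℕ
  row b₁ = List.sum (map (λ b₂ → indicator (P? (b₁ , b₂))) ps)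

∑-indicator-≟ : ∀ {n c} → 0 < c → c ≤ n → ∑[ j < n ] indicator (suc (toℕ j) ≟ c) ≡ 1
∑-indicator-≟ {_}     {zero}        ()  _
∑-indicator-≟ {zero}  {suc _}       _   ()
∑-indicator-≟ {suc n} {suc zero}    _   _           = cong suc (sum-replicate-zero n)
∑-indicator-≟ {suc n} {suc (suc c)} _   (s≤s 1+c≤n) = ∑-indicator-≟ {n} {suc c} z<s 1+c≤n

∣-∑ : ∀ {d n} (f : Fin n → ℕ) → (∀ i → d ∣ f i) → d ∣ ∑[ i < n ] f i
∣-∑ {d} {zero}  f d∣f = d ∣0
∣-∑ {d} {suc n} f d∣f = ∣m∣n⇒∣m+n (d∣f zero) (∣-∑ (f ∘ suc) (d∣f ∘ suc))

-- Reindexing finite sums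

injective⇒surjective : ∀ {n} {f : Fin n → Fin n} → Injective _≡_ _≡_ f → ∀ j → ∃ λ i → f i ≡ j
injective⇒surjective {suc n} {f} f-inj j with any? (λ i → f i ≟ᶠ j)
... | yes hit  = hit
... | no  miss =
  contradiction (injective⇒≤ {f = λ i → punchOut (j≢f i)} punchOut∘f-injective) 1+n≰n
  where
  j≢f : ∀ i → j ≢ f i
  j≢f i j≡fi = miss (i , sym j≡fi)

  punchOut∘f-injective : Injective _≡_ _≡_ (λ i → punchOut (j≢f i))
  punchOut∘f-injective eq = f-inj (punchOut-injective (j≢f _) (j≢f _) eq)

∑-∘-injective : ∀ {n} (f : Fin n → Fin n) → Injective _≡_ _≡_ f →
                (g : Fin n → ℕ) → ∑[ i < n ] g (f i) ≡ ∑[ i < n ] g i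
∑-∘-injective {n} f f-inj g = sym (sum-permute g (permutation f f⁻¹ f∘f⁻¹ f⁻¹∘f))
  where
  f⁻¹ : Fin n → Fin n
  f⁻¹ j = proj₁ (injective⇒surjective f-inj j)

  f∘f⁻¹ : ∀ j → f (f⁻¹ j) ≡ j
  f∘f⁻¹ j = proj₂ (injective⇒surjective f-inj j)

  f⁻¹∘f : ∀ i → f⁻¹ (f i) ≡ i
  f⁻¹∘f i = f-inj (f∘f⁻¹ (f i))

∑-reindex-positives : ∀ {h} (f : ℕ → ℕ) →
  (∀ {x} → 0 < x → x ≤ h → 0 < f x × f x ≤ h) →
  (∀ {x x′} → 0 < x → x ≤ h → 0 < x′ → x′ ≤ h → f x ≡ f x′ → x ≡ x′) →
  ∑[ i < h ] f (suc (toℕ i)) ≡ ∑[ i < h ] suc (toℕ i)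
∑-reindex-positives {h} f f-into f-injective = begin
  ∑[ i < h ] f (pos i)   ≡⟨ sum-cong-≗ {h} (λ i → sym (pos∘F i)) ⟩
  ∑[ i < h ] pos (F i)   ≡⟨ ∑-∘-injective F F-injective pos ⟩
  ∑[ i < h ] pos i       ∎
  where
  open ≡-Reasoning
  pos : Fin h → ℕ
  pos i = suc (toℕ i)

  toFin : ∀ {x} → 0 < x × x ≤ h → Fin h
  toFin {suc x} (_ , x<h) = fromℕ< x<h

  pos∘toFin : ∀ {x} (x∈ : 0 < x × x ≤ h) → pos (toFin x∈) ≡ x
  pos∘toFin {suc x} (_ , x<h) = cong suc (toℕ-fromℕ< x<h)

  F : Fin h → Fin h
  F i = toFin (f-into z<s (toℕ<n i))

  pos∘F : ∀ i → pos (F i) ≡ f (pos i)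
  pos∘F i = pos∘toFin (f-into z<s (toℕ<n i))

  F-injective : Injective _≡_ _≡_ F
  F-injective {i} {j} Fi≡Fj = toℕ-injective (suc-injective (f-injective z<s (toℕ<n i) z<s (toℕ<n j)
    (trans (sym (pos∘F i)) (trans (cong pos Fi≡Fj) (pos∘F j)))))

triangle : ℕ → ℕ
triangle h = ∑[ i < h ] suc (toℕ i)

∑-suc : ∀ {n} (f : Fin n → ℕ) → ∑[ i < n ] suc (f i) ≡ n + ∑[ i < n ] f i
∑-suc {zero}  f = refl
∑-suc {suc n} f = cong suc (begin
  f zero + ∑[ i < n ] suc (f (suc i))  ≡⟨ cong (_+_ (f zero)) (∑-suc (f ∘ suc)) ⟩
  f zero + (n + ∑[ i < n ] f (suc i))  ≡⟨ x∙yz≈y∙xz (f zero) n _ ⟩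
  n + (f zero + ∑[ i < n ] f (suc i))  ∎)
  where open ≡-Reasoning

triangle-suc : ∀ h → triangle (suc h) ≡ suc h + triangle h
triangle-suc h = cong suc (∑-suc {h} (λ i → suc (toℕ i)))

triangle-parity : ∀ h → 2 ∣ triangle h + suc h / 2
triangle-parity zero          = 2 ∣0
triangle-parity (suc zero)    = ∣-refl
triangle-parity (suc (suc h)) =
  subst (2 ∣_) (sym unfold) (∣m∣n⇒∣m+n (triangle-parity h) (2∣n+n (2 + h)))
  where
  open ≡-Reasoning
  regroup : ∀ h t c → 2 + h + (1 + h + t) + (1 + c) ≡ t + c + (2 + h + (2 + h))
  regroup = solve-∀

  unfold : triangle (2 + h) + (3 + h) / 2 ≡ triangle h + suc h / 2 + (2 + h + (2 + h))
  unfold = begin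
    triangle (2 + h) + (3 + h) / 2
      ≡⟨ cong₂ _+_ (trans (triangle-suc (suc h)) (cong (_+_ (2 + h)) (triangle-suc h)))
                   (m/n≡1+[m∸n]/n {3 + h} {2} (s≤s (s≤s z≤n))) ⟩
    2 + h + (1 + h + triangle h) + (1 + suc h / 2)
      ≡⟨ regroup h (triangle h) (suc h / 2) ⟩
    triangle h + suc h / 2 + (2 + h + (2 + h)) ∎

-- Residues modulo k

gcd-negˡ : ∀ i j → gcd (ℤ.- i) j ≡ gcd i j
gcd-negˡ i j = cong (λ a → + ℕ.gcd a ℤ.∣ j ∣) (ℤ.∣-i∣≡∣i∣ i)

module _ {k : ℕ} .{{_ : NonZero k}} where

  residues-unique : ∀ {a b} → a < k → b < k → + k ℤ.∣ + a ℤ.- + b → a ≡ b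
  residues-unique {a} {b} a<k b<k k∣a-b =
    ℤ.+-injective (ℤ.i-j≡0⇒i≡j (+ a) (+ b) (ℤ.∣i∣≡0⇒i≡0 (∣∧<⇒≡0 (ℤ.∣⇒∣ᵤ k∣a-b) ∣a-b∣<k)))
    where
    ∣a-b∣<k : ℤ.∣ + a ℤ.- + b ∣ < k
    ∣a-b∣<k = subst (_< k) (cong ℤ.∣_∣ (sym (ℤ.m-n≡m⊖n a b)))
                    (≤-<-trans (ℤ.∣m⊝n∣≤m⊔n a b) (⊔-pres-<m a<k b<k))

  remainder-congruent : ∀ i → + k ℤ.∣ + (i %ℕ k) ℤ.- i
  remainder-congruent i = ℤ.divides (ℤ.- q) (begin
    + r ℤ.- i                    ≡⟨ cong (ℤ._-_ (+ r)) (a≡a%ℕn+[a/ℕn]*n i k) ⟩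
    + r ℤ.- (+ r ℤ.+ q ℤ.* + k)  ≡⟨ r-[r+qk]≡-qk (+ r) q (+ k) ⟩
    ℤ.- q ℤ.* + k                ∎)
    where
    open ≡-Reasoning
    r : ℕ
    r = i %ℕ k

    q : ℤ
    q = i /ℕ k

    r-[r+qk]≡-qk : ∀ r q k → r ℤ.- (r ℤ.+ q ℤ.* k) ≡ ℤ.- q ℤ.* k
    r-[r+qk]≡-qk = ℤ.solve-∀

  unit-cancel : ∀ {m i} → gcd m (+ k) ≡ 1ℤ → + k ℤ.∣ m ℤ.* i → + k ℤ.∣ i
  unit-cancel {m} {i} gcd≡1 k∣mi = ℤ.∣ᵤ⇒∣ (coprime-divisor (+ k) m i k⊥m (ℤ.∣⇒∣ᵤ k∣mi))
    where
    k⊥m : Coprimality.Coprime k ℤ.∣ m ∣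
    k⊥m = Coprimality.sym (Coprimality.gcd≡1⇒coprime (ℤ.+-injective gcd≡1))

  module _ (m : ℤ) (m-unit : gcd m (+ k) ≡ 1ℤ) where

    unit-∤ : ∀ {x} → 0 < x → x < k → ¬ (+ k ℤ.∣ m ℤ.* + x)
    unit-∤ 0<x x<k k∣mx = m<n⇒n≢0 0<x (∣∧<⇒≡0 (ℤ.∣⇒∣ᵤ (unit-cancel {m} m-unit k∣mx)) x<k)

    residue-nonzero : ∀ {x} → 0 < x → x < k → 0 < (m ℤ.* + x) %ℕ k
    residue-nonzero {x} 0<x x<k = n≢0⇒n>0 (unit-∤ 0<x x<k ∘ k∣mx)
      where
      -[0-i]≡i : ∀ i → ℤ.- (0ℤ ℤ.- i) ≡ i
      -[0-i]≡i = ℤ.solve-∀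

      k∣mx : (m ℤ.* + x) %ℕ k ≡ 0 → + k ℤ.∣ m ℤ.* + x
      k∣mx r≡0 = subst (+ k ℤ.∣_) (-[0-i]≡i (m ℤ.* + x)) (ℤ.∣m⇒∣-m
        (subst (λ r → + k ℤ.∣ + r ℤ.- m ℤ.* + x) r≡0 (remainder-congruent (m ℤ.* + x))))

    residue-injective : ∀ {x x′} → x < k → x′ < k →
                        (m ℤ.* + x) %ℕ k ≡ (m ℤ.* + x′) %ℕ k → x ≡ x′
    residue-injective {x} {x′} x<k x′<k r≡r′ =
      residues-unique x<k x′<k (unit-cancel {m} m-unit k∣m[x-x′])
      where
      r′ : ℕ
      r′ = (m ℤ.* + x′) %ℕ k

      [r-a]-[r-b]≡m[x-x′] : ∀ r m x x′ → (r ℤ.- m ℤ.* x′) ℤ.- (r ℤ.- m ℤ.* x) ≡ m ℤ.* (x ℤ.- x′)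
      [r-a]-[r-b]≡m[x-x′] = ℤ.solve-∀

      k∣m[x-x′] : + k ℤ.∣ m ℤ.* (+ x ℤ.- + x′)
      k∣m[x-x′] = subst (+ k ℤ.∣_) ([r-a]-[r-b]≡m[x-x′] (+ r′) m (+ x) (+ x′))
        (ℤ.∣m∣n⇒∣m-n (remainder-congruent (m ℤ.* + x′))
          (subst (λ r → + k ℤ.∣ + r ℤ.- m ℤ.* + x) r≡r′ (remainder-congruent (m ℤ.* + x))))

    residue-+≢k : ∀ {x x′} → 0 < x → x + x′ < k → (m ℤ.* + x) %ℕ k + (m ℤ.* + x′) %ℕ k ≢ k
    residue-+≢k {x} {x′} 0<x x+x′<k r+r′≡k =
      unit-∤ (<-≤-trans 0<x (m≤m+n x x′)) x+x′<k (subst (+ k ℤ.∣_) k-δ≡m[x+x′] k∣k-δ)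
      where
      open ≡-Reasoning
      r r′ : ℕ
      r  = (m ℤ.* + x) %ℕ k
      r′ = (m ℤ.* + x′) %ℕ k

      δ : ℤ
      δ = (+ r ℤ.- m ℤ.* + x) ℤ.+ (+ r′ ℤ.- m ℤ.* + x′)

      k∣k-δ : + k ℤ.∣ + k ℤ.- δ
      k∣k-δ = ℤ.∣m∣n⇒∣m-n ℤ.∣-refl
        (ℤ.∣m∣n⇒∣m+n (remainder-congruent (m ℤ.* + x)) (remainder-congruent (m ℤ.* + x′)))

      cancel : ∀ r r′ m x x′ →
               (r ℤ.+ r′) ℤ.- ((r ℤ.- m ℤ.* x) ℤ.+ (r′ ℤ.- m ℤ.* x′)) ≡ m ℤ.* (x ℤ.+ x′)
      cancel = ℤ.solve-∀

      k-δ≡m[x+x′] : + k ℤ.- δ ≡ m ℤ.* + (x + x′)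
      k-δ≡m[x+x′] = begin
        + k ℤ.- δ                 ≡⟨ cong (λ t → + t ℤ.- δ) r+r′≡k ⟨
        + (r + r′) ℤ.- δ          ≡⟨ cong (ℤ._- δ) (ℤ.pos-+ r r′) ⟩
        (+ r ℤ.+ + r′) ℤ.- δ      ≡⟨ cancel (+ r) (+ r′) m (+ x) (+ x′) ⟩
        m ℤ.* (+ x ℤ.+ + x′)      ≡⟨ cong (ℤ._*_ m) (ℤ.pos-+ x x′) ⟨
        m ℤ.* + (x + x′)          ∎

absResidue : ℕ → ℕ → ℕ
absResidue k r = r ⊓ (k ∸ r)

absResidue-pos : ∀ {k r} → 0 < r → r < k → 0 < absResidue k r
absResidue-pos 0<r r<k = ⊓-glb 0<r (m<n⇒0<n∸m r<k)

absResidue-≡ : ∀ {k a b} → a ≤ k → b ≤ k → absResidue k a ≡ absResidue k b → a ≡ b ⊎ a + b ≡ k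
absResidue-≡ {k} {a} {b} a≤k b≤k eq with ⊓-sel a (k ∸ a) | ⊓-sel b (k ∸ b)
... | inj₁ ∣a∣≡a   | inj₁ ∣b∣≡b   = inj₁ (trans (sym ∣a∣≡a) (trans eq ∣b∣≡b))
... | inj₁ ∣a∣≡a   | inj₂ ∣b∣≡k∸b =
  inj₂ (trans (cong (_+ b) (trans (sym ∣a∣≡a) (trans eq ∣b∣≡k∸b))) (m∸n+n≡m b≤k))
... | inj₂ ∣a∣≡k∸a | inj₁ ∣b∣≡b   =
  inj₂ (trans (cong (_+_ a) (trans (sym ∣b∣≡b) (trans (sym eq) ∣a∣≡k∸a))) (m+[n∸m]≡n a≤k))
... | inj₂ ∣a∣≡k∸a | inj₂ ∣b∣≡k∸b =
  inj₁ (∸-cancelˡ-≡ a≤k b≤k (trans (sym ∣a∣≡k∸a) (trans eq ∣b∣≡k∸b)))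

-- The odd modulus k = 2h + 1

module _ (h : ℕ) where

  private
    k : ℕ
    k = suc (h + h)

    ≤h⇒<k : ∀ {x} → x ≤ h → x < k
    ≤h⇒<k x≤h = s≤s (≤-trans x≤h (m≤m+n h h))

    k<1+h+1+h : k < suc h + suc h
    k<1+h+1+h = s≤s (≤-reflexive (sym (+-suc h h)))

  absResidue-≤h : ∀ {r} → r ≤ h → absResidue k r ≡ r
  absResidue-≤h {r} r≤h =
    m≤n⇒m⊓n≡m (m+n≤o⇒m≤o∸n r (≤-trans (+-mono-≤ r≤h r≤h) (n≤1+n (h + h))))

  absResidue->h : ∀ {r} → h < r → r ≤ k → absResidue k r + r ≡ k
  absResidue->h {r} h<r r≤k =
    trans (cong (_+ r) (m≥n⇒m⊓n≡n (m≤n+o⇒m∸n≤o k r (+-mono-≤ h<r (<⇒≤ h<r))))) (m∸n+n≡m r≤k)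

  absResidue≤h : ∀ r → absResidue k r ≤ h
  absResidue≤h r with r ≤? h
  ... | yes r≤h = ≤-trans (m⊓n≤m r (k ∸ r)) r≤h
  ... | no  r≰h = ≤-trans (m⊓n≤n r (k ∸ r)) (m≤n+o⇒m∸n≤o k r (+-monoˡ-≤ h (≰⇒> r≰h)))

  -- The inequalities of Counted for the pair (b, y), given b ≤ h.
  Region : ℕ → ℕ → Set
  Region b y = y ≤ h × suc h ≤ b + y

  region? : ∀ b y → Dec (Region b y)
  region? b y = y ≤? h ×-dec suc h ≤? b + y

  module RowSum {b y z : ℕ} (0<b : 0 < b) (b≤h : b ≤ h) (y<k : y < k) (z<k : z < k)
                (k∣b+y+z : k ∣ b + y + z) where

    open ≡-Reasoning

    ∣y∣ ∣z∣ : ℕ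
    ∣y∣ = absResidue k y
    ∣z∣ = absResidue k z

    b+y+z≡k : y ≤ h ⊎ z ≤ h → b + y + z ≡ k
    b+y+z≡k y≤h⊎z≤h = middle-multiple k∣b+y+z (k ∣0) 0<b+y+z (b+y+z<k+k y≤h⊎z≤h)
      where
      0<b+y+z : 0 < b + y + z
      0<b+y+z = <-≤-trans 0<b (≤-trans (m≤m+n b y) (m≤m+n (b + y) z))

      b+y+z<k+k : y ≤ h ⊎ z ≤ h → b + y + z < k + k
      b+y+z<k+k (inj₁ y≤h) = +-mono-< (s≤s (+-mono-≤ b≤h y≤h)) z<k
      b+y+z<k+k (inj₂ z≤h) =
        subst (_< k + k) (xy∙z≈xz∙y b z y) (+-mono-< (s≤s (+-mono-≤ b≤h z≤h)) y<k)

    b+y+z≡k+k : h < y → h < z → b + y + z ≡ k + k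
    b+y+z≡k+k h<y h<z = middle-multiple k∣b+y+z ∣-refl k<b+y+z b+y+z<k+k+k
      where
      k<b+y+z : k < b + y + z
      k<b+y+z = <-≤-trans k<1+h+1+h
        (≤-trans (+-mono-≤ h<y h<z) (subst (y + z ≤_) (sym (+-assoc b y z)) (m≤n+m (y + z) b)))

      b+y+z<k+k+k : b + y + z < k + k + k
      b+y+z<k+k+k = +-mono-< (+-mono-< (≤h⇒<k b≤h) y<k) z<k

    low-low : y ≤ h → z ≤ h → indicator (region? b y) + b + ∣y∣ + ∣z∣ ≡ 2 + (h + h)
    low-low y≤h z≤h = begin
      indicator (region? b y) + b + ∣y∣ + ∣z∣
        ≡⟨ cong₂ (λ c u → c + b + u + ∣z∣) (indicator-yes (region? b y) region) (absResidue-≤h y≤h) ⟩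
      1 + b + y + ∣z∣      ≡⟨ cong (_+_ (1 + b + y)) (absResidue-≤h z≤h) ⟩
      1 + b + y + z        ≡⟨ cong suc (b+y+z≡k (inj₁ y≤h)) ⟩
      2 + (h + h)          ∎
      where
      region : Region b y
      region = y≤h , +-cancelʳ-≤ z (suc h) (b + y)
        (≤-trans (+-monoʳ-≤ (suc h) z≤h) (≤-reflexive (sym (b+y+z≡k (inj₁ y≤h)))))

    low-high : y ≤ h → h < z → indicator (region? b y) + b + ∣y∣ + ∣z∣ ≡ (b + y) + (b + y)
    low-high y≤h h<z = begin
      indicator (region? b y) + b + ∣y∣ + ∣z∣
        ≡⟨ cong₂ (λ c u → c + b + u + ∣z∣) (indicator-no (region? b y) ¬region) (absResidue-≤h y≤h) ⟩
      b + y + ∣z∣          ≡⟨ cong (_+_ (b + y)) ∣z∣≡b+y ⟩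
      b + y + (b + y)      ∎
      where
      ¬region : ¬ Region b y
      ¬region (_ , 1+h≤b+y) = <-irrefl refl (<-≤-trans k<1+h+1+h
        (subst (suc h + suc h ≤_) (b+y+z≡k (inj₁ y≤h)) (+-mono-≤ 1+h≤b+y h<z)))

      ∣z∣≡b+y : ∣z∣ ≡ b + y
      ∣z∣≡b+y = +-cancelʳ-≡ z ∣z∣ (b + y)
        (trans (absResidue->h h<z (<⇒≤ z<k)) (sym (b+y+z≡k (inj₁ y≤h))))

    high-low : h < y → z ≤ h → indicator (region? b y) + b + ∣y∣ + ∣z∣ ≡ (b + z) + (b + z)
    high-low h<y z≤h = begin
      indicator (region? b y) + b + ∣y∣ + ∣z∣
        ≡⟨ cong₂ (λ c u → c + b + u + ∣z∣) (indicator-no (region? b y) ¬region) ∣y∣≡b+z ⟩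
      b + (b + z) + ∣z∣    ≡⟨ cong (_+_ (b + (b + z))) (absResidue-≤h z≤h) ⟩
      b + (b + z) + z      ≡⟨ regroup b z ⟩
      b + z + (b + z)      ∎
      where
      ¬region : ¬ Region b y
      ¬region (y≤h , _) = <⇒≱ h<y y≤h

      ∣y∣≡b+z : ∣y∣ ≡ b + z
      ∣y∣≡b+z = +-cancelʳ-≡ y ∣y∣ (b + z)
        (trans (absResidue->h h<y (<⇒≤ y<k)) (trans (sym (b+y+z≡k (inj₂ z≤h))) (xy∙z≈xz∙y b y z)))

      regroup : ∀ b z → b + (b + z) + z ≡ b + z + (b + z)
      regroup = solve-∀

    high-high : h < y → h < z → indicator (region? b y) + b + ∣y∣ + ∣z∣ ≡ b + b
    high-high h<y h<z = begin
      indicator (region? b y) + b + ∣y∣ + ∣z∣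
        ≡⟨ cong (λ c → c + b + ∣y∣ + ∣z∣) (indicator-no (region? b y) ¬region) ⟩
      b + ∣y∣ + ∣z∣        ≡⟨ +-assoc b ∣y∣ ∣z∣ ⟩
      b + (∣y∣ + ∣z∣)      ≡⟨ cong (_+_ b) b≡∣y∣+∣z∣ ⟨
      b + b                ∎
      where
      ¬region : ¬ Region b y
      ¬region (y≤h , _) = <⇒≱ h<y y≤h

      swap-middle : ∀ a b c d → a + b + (c + d) ≡ a + c + (b + d)
      swap-middle = solve-∀

      b≡∣y∣+∣z∣ : b ≡ ∣y∣ + ∣z∣
      b≡∣y∣+∣z∣ = +-cancelʳ-≡ (y + z) b (∣y∣ + ∣z∣) (begin
        b + (y + z)          ≡⟨ +-assoc b y z ⟨
        b + y + z            ≡⟨ b+y+z≡k+k h<y h<z ⟩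
        k + k                ≡⟨ cong₂ _+_ (absResidue->h h<y (<⇒≤ y<k)) (absResidue->h h<z (<⇒≤ z<k)) ⟨
        ∣y∣ + y + (∣z∣ + z)  ≡⟨ swap-middle ∣y∣ y ∣z∣ z ⟩
        ∣y∣ + ∣z∣ + (y + z)  ∎)

  row-parity : ∀ {b y z} → 0 < b → b ≤ h → y < k → z < k → k ∣ b + y + z →
               2 ∣ indicator (region? b y) + b + absResidue k y + absResidue k z
  row-parity {b} {y} {z} 0<b b≤h y<k z<k k∣b+y+z = by-cases (y ≤? h) (z ≤? h)
    where
    open RowSum 0<b b≤h y<k z<k k∣b+y+z

    by-cases : Dec (y ≤ h) → Dec (z ≤ h) → 2 ∣ indicator (region? b y) + b + ∣y∣ + ∣z∣
    by-cases (yes y≤h) (yes z≤h) = subst (2 ∣_) (sym (low-low y≤h z≤h)) (∣m∣n⇒∣m+n ∣-refl (2∣n+n h))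
    by-cases (yes y≤h) (no  z≰h) = subst (2 ∣_) (sym (low-high y≤h (≰⇒> z≰h))) (2∣n+n (b + y))
    by-cases (no  y≰h) (yes z≤h) = subst (2 ∣_) (sym (high-low (≰⇒> y≰h) z≤h)) (2∣n+n (b + z))
    by-cases (no  y≰h) (no  z≰h) = subst (2 ∣_) (sym (high-high (≰⇒> y≰h) (≰⇒> z≰h))) (2∣n+n b)

  module _ (m : ℤ) (m-unit : gcd m (+ k) ≡ 1ℤ) where

    ∑-absResidue-multiples : ∑[ i < h ] absResidue k ((m ℤ.* + suc (toℕ i)) %ℕ k) ≡ triangle h
    ∑-absResidue-multiples = ∑-reindex-positives ∣m*_∣ into injective
      where
      ∣m*_∣ : ℕ → ℕ
      ∣m* x ∣ = absResidue k ((m ℤ.* + x) %ℕ k)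

      residue<k : ∀ x → (m ℤ.* + x) %ℕ k < k
      residue<k x = n%ℕd<d (m ℤ.* + x) k

      into : ∀ {x} → 0 < x → x ≤ h → 0 < ∣m* x ∣ × ∣m* x ∣ ≤ h
      into {x} 0<x x≤h =
        absResidue-pos (residue-nonzero m m-unit 0<x (≤h⇒<k x≤h)) (residue<k x) , absResidue≤h _

      injective : ∀ {x x′} → 0 < x → x ≤ h → 0 < x′ → x′ ≤ h → ∣m* x ∣ ≡ ∣m* x′ ∣ → x ≡ x′
      injective {x} {x′} 0<x x≤h _ x′≤h eq
        with absResidue-≡ (<⇒≤ (residue<k x)) (<⇒≤ (residue<k x′)) eq
      ... | inj₁ r≡r′   = residue-injective m m-unit (≤h⇒<k x≤h) (≤h⇒<k x′≤h) r≡r′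
      ... | inj₂ r+r′≡k = contradiction r+r′≡k (residue-+≢k m m-unit 0<x (s≤s (+-mono-≤ x≤h x′≤h)))

  module _ (n : ℤ) (n-unit : gcd n (+ k) ≡ 1ℤ) (n+1-unit : gcd (n +ℤ 1ℤ) (+ k) ≡ 1ℤ) where

    private
      y z : ℕ → ℕ
      y b = (n ℤ.* + b) %ℕ k
      z b = (ℤ.- (n +ℤ 1ℤ) ℤ.* + b) %ℕ k

      -[n+1]-unit : gcd (ℤ.- (n +ℤ 1ℤ)) (+ k) ≡ 1ℤ
      -[n+1]-unit = trans (gcd-negˡ (n +ℤ 1ℤ) (+ k)) n+1-unit

      [k+1]/2≡1+h : (k + 1) / 2 ≡ suc h
      [k+1]/2≡1+h = trans (cong (_/ 2) (k+1≡[1+h]*2 h)) (m*n/n≡m (suc h) 2)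
        where
        k+1≡[1+h]*2 : ∀ h → suc (h + h) + 1 ≡ suc h * 2
        k+1≡[1+h]*2 = solve-∀

      [k∸1]/2≡h : (k ∸ 1) / 2 ≡ h
      [k∸1]/2≡h = trans (cong (_/ 2) (n+n≡n*2 h)) (m*n/n≡m h 2)

      [k+1]/4≡[1+h]/2 : (k + 1) / 4 ≡ suc h / 2
      [k+1]/4≡[1+h]/2 = trans (cong (_/ 4) (k+1≡2*[1+h] h)) (m*n/m*o≡n/o 2 (suc h) 2)
        where
        k+1≡2*[1+h] : ∀ h → suc (h + h) + 1 ≡ 2 * suc h
        k+1≡2*[1+h] = solve-∀

    k∣b+y+z : ∀ b → k ∣ b + y b + z b
    k∣b+y+z b = ℤ.∣⇒∣ᵤ (subst (+ k ℤ.∣_) sum≡b+y+z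
      (ℤ.∣m∣n⇒∣m+n (remainder-congruent (n ℤ.* + b)) (remainder-congruent (ℤ.- (n +ℤ 1ℤ) ℤ.* + b))))
      where
      open ≡-Reasoning
      cancel : ∀ b y z n → (y ℤ.- n ℤ.* b) ℤ.+ (z ℤ.- ℤ.- (n ℤ.+ 1ℤ) ℤ.* b) ≡ b ℤ.+ y ℤ.+ z
      cancel = ℤ.solve-∀

      sum≡b+y+z : (+ y b ℤ.- n ℤ.* + b) ℤ.+ (+ z b ℤ.- ℤ.- (n +ℤ 1ℤ) ℤ.* + b) ≡ + (b + y b + z b)
      sum≡b+y+z = begin
        (+ y b ℤ.- n ℤ.* + b) ℤ.+ (+ z b ℤ.- ℤ.- (n +ℤ 1ℤ) ℤ.* + b)
          ≡⟨ cancel (+ b) (+ y b) (+ z b) n ⟩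
        + b ℤ.+ + y b ℤ.+ + z b
          ≡⟨ cong (ℤ._+ + z b) (ℤ.pos-+ b (y b)) ⟨
        + (b + y b) ℤ.+ + z b
          ≡⟨ ℤ.pos-+ (b + y b) (z b) ⟨
        + (b + y b + z b) ∎

    counted⇔ : ∀ {b b₂} → b₂ ≤ h → Counted k n (b , b₂) ⇔ (b₂ ≡ y b × Region b (y b))
    counted⇔ {b} {b₂} b₂≤h = mk⇔ to from
      where
      to : Counted k n (b , b₂) → b₂ ≡ y b × Region b (y b)
      to (half≤b+b₂ , k∣b₂-nb) =
        b₂≡y , subst (Region b) b₂≡y (b₂≤h , subst (_≤ b + b₂) [k+1]/2≡1+h half≤b+b₂)
        where
        cancel : ∀ b₂ y nb → (b₂ ℤ.- nb) ℤ.- (y ℤ.- nb) ≡ b₂ ℤ.- y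
        cancel = ℤ.solve-∀

        k∣b₂-y : + k ℤ.∣ + b₂ ℤ.- + y b
        k∣b₂-y = subst (+ k ℤ.∣_) (cancel (+ b₂) (+ y b) (n ℤ.* + b))
          (ℤ.∣m∣n⇒∣m-n (ℤ.∣ᵤ⇒∣ {i = + b₂ ℤ.- n ℤ.* + b} k∣b₂-nb) (remainder-congruent (n ℤ.* + b)))

        b₂≡y : b₂ ≡ y b
        b₂≡y = residues-unique (≤h⇒<k b₂≤h) (n%ℕd<d (n ℤ.* + b) k) k∣b₂-y

      from : b₂ ≡ y b × Region b (y b) → Counted k n (b , b₂)
      from (b₂≡y , _ , 1+h≤b+y) = subst (λ c → Counted k n (b , c)) (sym b₂≡y)
        (subst (_≤ b + y b) (sym [k+1]/2≡1+h) 1+h≤b+y , ℤ.∣⇒∣ᵤ (remainder-congruent (n ℤ.* + b)))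

    row-count : ∀ {b} → 0 < b → b ≤ h →
                ∑[ j < h ] indicator (counted? k n (b , suc (toℕ j))) ≡ indicator (region? b (y b))
    row-count {b} 0<b b≤h = by-cases (region? b (y b))
      where
      counted?ⱼ : (j : Fin h) → Dec (Counted k n (b , suc (toℕ j)))
      counted?ⱼ j = counted? k n (b , suc (toℕ j))

      by-cases : (region-dec : Dec (Region b (y b))) →
                 ∑[ j < h ] indicator (counted?ⱼ j) ≡ indicator region-dec
      by-cases (yes region) = begin
        ∑[ j < h ] indicator (counted?ⱼ j)
          ≡⟨ sum-cong-≗ {h} (λ j → indicator-⇔ (counted⇔≡y j) (counted?ⱼ j) (suc (toℕ j) ≟ y b)) ⟩
        ∑[ j < h ] indicator (suc (toℕ j) ≟ y b)
          ≡⟨ ∑-indicator-≟ 0<y (proj₁ region) ⟩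
        1 ∎
        where
        open ≡-Reasoning
        0<y : 0 < y b
        0<y = residue-nonzero n n-unit 0<b (≤h⇒<k b≤h)

        counted⇔≡y : ∀ j → Counted k n (b , suc (toℕ j)) ⇔ (suc (toℕ j) ≡ y b)
        counted⇔≡y j = mk⇔ (proj₁ ∘ Equivalence.to (counted⇔ (toℕ<n j)))
                           (λ b₂≡y → Equivalence.from (counted⇔ (toℕ<n j)) (b₂≡y , region))
      by-cases (no ¬region) =
        trans (sum-cong-≗ {h} (λ j → indicator-no (counted?ⱼ j) (¬counted j))) (sum-replicate-zero h)
        where
        ¬counted : ∀ j → ¬ Counted k n (b , suc (toℕ j))
        ¬counted j = ¬region ∘ proj₂ ∘ Equivalence.to (counted⇔ (toℕ<n j))

    N≡∑region : N k n ≡ ∑[ i < h ] indicator (region? (suc (toℕ i)) (y (suc (toℕ i))))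
    N≡∑region = begin
      N k n
        ≡⟨ cong (λ m → length (filter (counted? k n) (cartesianProduct (positivesUpTo m) (positivesUpTo m))))
                [k∸1]/2≡h ⟩
      length (filter (counted? k n) (cartesianProduct (positivesUpTo h) (positivesUpTo h)))
        ≡⟨ length-filter-positivesUpTo² (counted? k n) h ⟩
      ∑[ i < h ] ∑[ j < h ] indicator (counted? k n (suc (toℕ i) , suc (toℕ j)))
        ≡⟨ sum-cong-≗ {h} (λ i → row-count z<s (toℕ<n i)) ⟩
      ∑[ i < h ] indicator (region? (suc (toℕ i)) (y (suc (toℕ i)))) ∎
      where open ≡-Reasoning

    2∣N+[1+h]/2 : 2 ∣ N k n + suc h / 2
    2∣N+[1+h]/2 =
      ∣m+n∣m⇒∣n (subst (2 ∣_) regroup (∣m∣n⇒∣m+n 2∣N+3T (triangle-parity h))) (2∣n+n (T + T))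
      where
      open ≡-Reasoning
      T : ℕ
      T = triangle h

      R B Y Z : Fin h → ℕ
      R i = indicator (region? (suc (toℕ i)) (y (suc (toℕ i))))
      B i = suc (toℕ i)
      Y i = absResidue k (y (suc (toℕ i)))
      Z i = absResidue k (z (suc (toℕ i)))

      row-parityᵢ : ∀ i → 2 ∣ R i + B i + Y i + Z i
      row-parityᵢ i = row-parity z<s (toℕ<n i) (n%ℕd<d (n ℤ.* + B i) k)
                                 (n%ℕd<d (ℤ.- (n +ℤ 1ℤ) ℤ.* + B i) k) (k∣b+y+z (B i))

      ∑rows≡N+3T : ∑[ i < h ] (R i + B i + Y i + Z i) ≡ N k n + T + T + T
      ∑rows≡N+3T = begin
        ∑[ i < h ] (R i + B i + Y i + Z i)
          ≡⟨ ∑-distrib-+ (λ i → R i + B i + Y i) Z ⟩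
        ∑[ i < h ] (R i + B i + Y i) + sum Z
          ≡⟨ cong (_+ sum Z) (∑-distrib-+ (λ i → R i + B i) Y) ⟩
        ∑[ i < h ] (R i + B i) + sum Y + sum Z
          ≡⟨ cong (λ t → t + sum Y + sum Z) (∑-distrib-+ R B) ⟩
        sum R + sum B + sum Y + sum Z
          ≡⟨ cong₂ _+_ (cong₂ _+_ (cong (_+ T) (sym N≡∑region)) (∑-absResidue-multiples n n-unit))
                       (∑-absResidue-multiples (ℤ.- (n +ℤ 1ℤ)) -[n+1]-unit) ⟩
        N k n + T + T + T ∎

      2∣N+3T : 2 ∣ N k n + T + T + T
      2∣N+3T = subst (2 ∣_) ∑rows≡N+3T (∣-∑ (λ i → R i + B i + Y i + Z i) row-parityᵢ)

      regroup′ : ∀ N T c → N + T + T + T + (T + c) ≡ T + T + (T + T) + (N + c)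
      regroup′ = solve-∀

      regroup : N k n + T + T + T + (T + suc h / 2) ≡ T + T + (T + T) + (N k n + suc h / 2)
      regroup = regroup′ (N k n) T (suc h / 2)

    N-parity : N k n % 2 ≡ ((k + 1) / 4) % 2
    N-parity = begin
      N k n % 2          ≡⟨ 2∣m+n⇒m%2≡n%2 (N k n) (suc h / 2) 2∣N+[1+h]/2 ⟩
      suc h / 2 % 2      ≡⟨ cong (_% 2) [k+1]/4≡[1+h]/2 ⟨
      (k + 1) / 4 % 2    ∎
      where open ≡-Reasoning

theorem1p2 : (k : ℕ) (n : ℤ) → k % 2 ≡ 1 →
    gcd n (+ k) ≡ 1ℤ → gcd (n +ℤ 1ℤ) (+ k) ≡ 1ℤ →
    N k n % 2 ≡ ((k + 1) / 4) % 2
theorem1p2 k n k-odd = subst Claim (sym k≡1+h+h) (N-parity h n)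
  where
  h : ℕ
  h = k / 2

  k≡1+h+h : k ≡ suc (h + h)
  k≡1+h+h = trans (m≡m%n+[m/n]*n k 2) (cong₂ _+_ k-odd (sym (n+n≡n*2 h)))

  Claim : ℕ → Set
  Claim k = gcd n (+ k) ≡ 1ℤ → gcd (n +ℤ 1ℤ) (+ k) ≡ 1ℤ → N k n % 2 ≡ ((k + 1) / 4) % 2
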